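{- Let $H=(V_H,E_H)$ be a realizable graph. Then for every induced cycle $C=(c_1,\dots,c_n)$ of $H$ of length $n\ge 4$, there exist two vertices $w_1,w_2\in V_H$ such that: (a) for every $i\in[n]$, both $\{w_1,c_i\}$ and $\{w_2,c_i\}$ belong to $E_H$; (b) the neighbourhoods of $w_1$ and $w_2$ are contained in the neighbourhood of $C$: if $\{v,w_1\}\in E_H$ or $\{v,w_2\}\in E_H$, then either $v$ is one of the $c_i$ or there exists $i$ with $\{v,c_i\}\in E_H$. Furthermore, if $\{w_1,w_2\}\notin E_H$, then for every $i\in[n]$ there exists a vertex $c_i'$ of $H$ such that $\{c_i,c_i'\}\in E_H$ and $\{c_{i+1},c_i'\}\in E_H$, with the convention $c_{n+1}=c_1$.
   Context: A directed multigraph $G=(V,E)$ has a finite vertex set $V$ and a finite multiset $E$ of arcs $(i,j)_k$ (loops and multiple arcs allowed). A simple cycle of $G$ is a closed sequence of arcs $(i_0,i_1)_{k_1}\cdots(i_{\ell-1},i_0)_{k_\ell}$, $\ell\ge1$, with all $i_t$ distinct, considered up to cyclic rotation (orientation and the specific arcs used matter; a self-loop is a simple cycle of length one). The hike dependency graph $\phi(G)$ is the simple graph whose vertices are the simple cycles of $G$, two distinct simple cycles being adjacent iff they share a vertex of $G$. A finite simple graph $H$ is realizable if $H\cong\phi(G)$ for some directed multigraph $G$. An induced cycle of $H$ is a cycle $c_1,\dots,c_n$ of distinct vertices with $\{c_i,c_{i+1}\}\in E_H$ (indices mod $n$) and no other edges of $H$ among these vertices. -}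

module Defs where

open import Data.Nat using (ℕ; zero; suc; _+_; _≤_)
open import Data.Nat.DivMod using (_mod_)
open import Data.Fin using (Fin; toℕ)
open import Data.Bool using (Bool; true; false)
open import Data.Product using (Σ; _×_; _,_; ∃; ∃-syntax)
open import Data.Sum using (_⊎_)
open import Relation.Binary.PropositionalEquality using (_≡_; _≢_)
open import Relation.Nullary using (¬_)
open import Function.Definitions using (Injective)

shift : {n : ℕ} → ℕ → Fin (suc n) → Fin (suc n)
shift {n} r t = (toℕ t + r) mod (suc n)

-- A finite directed multigraph: vertices Fin nV, arcs indexed by Fin nA
-- (so parallel arcs and loops are allowed; arcs are distinguished by index).
record DiGraph : Set where
  field
    nV  : ℕ
    nA  : ℕ
    src : Fin nA → Fin nV
    tgt : Fin nA → Fin nV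
open DiGraph public

record SimpleCycle (G : DiGraph) : Set where
  field
    len      : ℕ
    arc      : Fin (suc len) → Fin (nA G)
    chained  : ∀ t → tgt G (arc t) ≡ src G (arc (shift 1 t))
    distinct : Injective _≡_ _≡_ (λ t → src G (arc t))
open SimpleCycle public

_≈rot_ : {G : DiGraph} → SimpleCycle G → SimpleCycle G → Set
_≈rot_ {G} c d = Σ (len c ≡ len d) λ { _≡_.refl →
  Σ ℕ λ r → ∀ t → arc d t ≡ arc c (shift r t) }

ShareVertex : {G : DiGraph} → SimpleCycle G → SimpleCycle G → Set
ShareVertex {G} c d = ∃ λ t → ∃ λ s → src G (arc c t) ≡ src G (arc d s)

record SimpleGraph : Set where
  field
    N       : ℕ
    adj     : Fin N → Fin N → Bool
    adj-sym : ∀ u v → adj u v ≡ adj v u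
    adj-irr : ∀ u → adj u u ≡ false
open SimpleGraph public

Edge : (H : SimpleGraph) → Fin (N H) → Fin (N H) → Set
Edge H u v = adj H u v ≡ true

-- H ≅ φ(G): f picks a representative simple cycle for each vertex of H,
-- hitting every rotation class exactly once, and u,v are adjacent iff they
-- are distinct and their cycles share a vertex of G.
IsHikeDepGraphOf : SimpleGraph → DiGraph → Set
IsHikeDepGraphOf H G = Σ (Fin (N H) → SimpleCycle G) λ f →
    (∀ u v → f u ≈rot f v → u ≡ v)
  × (∀ (c : SimpleCycle G) → ∃ λ u → f u ≈rot c)
  × (∀ u v → (Edge H u v → (u ≢ v × ShareVertex (f u) (f v)))
           × ((u ≢ v × ShareVertex (f u) (f v)) → Edge H u v))

Realizable : SimpleGraph → Set
Realizable H = ∃ λ G → IsHikeDepGraphOf H G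

-- Induced cycle c₀ … c_{n-1} (n = suc m) in H, indices cyclic via shift 1.
record InducedCycle (H : SimpleGraph) (m : ℕ) : Set where
  field
    vtx      : Fin (suc m) → Fin (N H)
    inj      : Injective _≡_ _≡_ vtx
    consec   : ∀ i → Edge H (vtx i) (vtx (shift 1 i))
    no-chord : ∀ i j → Edge H (vtx i) (vtx j) → (j ≡ shift 1 i) ⊎ (i ≡ shift 1 j)
open InducedCycle public

-- Write γᵢ for the cycle of G that represents cᵢ. Consecutive γᵢ share a vertex xᵢ, while
-- γᵢ₋₁ and γᵢ₊₁ are disjoint because C is induced and has length at least 4. For an arc a
-- let flux i a be +1 if a is an arc of γᵢ leaving γᵢ₋₁, −1 if it is an arc of γᵢ entering
-- γᵢ₋₁, and 0 otherwise. On arcs of ⋃ γ, flux (i + 1) − flux i is the coboundary of the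
-- indicator of γᵢ ∖ γᵢ₋₁, so all the flux i have the same total around a cycle of ⋃ γ.
-- Following every γᵢ from xᵢ₋₁ to xᵢ gives a closed walk whose flux₀ is 1; following every
-- γᵢ back from xᵢ to xᵢ₋₁ gives one whose flux₀ is −1. A closed walk contains a simple
-- cycle whose total has the same sign as its own. Such a cycle has nonzero total flux i
-- for every i, so it uses an arc of every γᵢ: the vertex of H it represents is adjacent to
-- every cᵢ, and each of its neighbours meets some γᵢ, which gives (b). The two cycles have
-- totals of opposite signs, so they represent distinct vertices w₁ and w₂, and the last
-- clause holds with cᵢ′ = w₁.

module Submission where

open import Defs
open import Data.Nat using (ℕ; suc; _≤_)
open import Data.Fin using (Fin)
open import Data.Product using (Σ; _×_; ∃)
open import Data.Sum using (_⊎_)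
open import Relation.Binary.PropositionalEquality using (_≡_; _≢_)
open import Relation.Nullary using (¬_)

open import Algebra.Bundles using (AbelianGroup)
open import Data.Bool using (Bool; true; false; _∧_; not)
open import Data.Bool.Properties using (∧-zeroʳ)
open import Data.Empty using (⊥; ⊥-elim)
open import Data.Fin using (toℕ; zero; suc)
open import Data.Fin.Permutation using (permutation)
open import Data.Fin.Properties using (any?; ¬∀⟶∃¬; toℕ<n) renaming (_≟_ to _≟ᶠ_)
import Data.Integer.Properties as ℤ
open import Data.Integer.Tactic.RingSolver using (solve-∀)
open import Data.List using (List; []; _∷_; _++_; map; lookup)
import Data.List as List
import Data.List.Properties as List
open import Data.List.Membership.Propositional using (_∈_; _∉_)
open import Data.List.Membership.Propositional.Properties
  using (∈-++⁺ˡ; ∈-++⁺ʳ; ∈-++⁻; ∈-map⁺; ∈-lookup)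
open import Data.List.Relation.Binary.Subset.Propositional using (_⊆_)
open import Data.List.Relation.Unary.Any using (here; there)
open import Data.Nat as ℕ using (zero; z≤n; s≤s)
import Data.Nat.Properties as ℕ
open import Data.Nat.GeneralisedArithmetic using (iterate)
open import Data.Product using (_,_; proj₁; proj₂)
open import Data.Sum using (inj₁; inj₂; [_,_]′)
open import Data.Unit using (⊤; tt)
open import Function using (_∘_; _∘′_)
open import Relation.Binary.PropositionalEquality
  using (refl; sym; trans; cong; cong₂; subst; module ≡-Reasoning)
open import Relation.Nullary using (Dec; yes; no; does)
open import Relation.Nullary.Decidable using (dec-true; dec-false; decidable-stable)

module CyclicShift {n : ℕ} where

  open import Data.Nat using (_+_; _*_; _<_; _%_)
  open import Data.Nat.DivMod
    using (%-distribˡ-+; m%n%n≡m%n; [m+kn]%n≡m%n; m<n⇒m%n≡m; m≤n⇒m%n≡m; n%n≡0; m%n<n)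
  open import Data.Nat.Properties
    using (+-assoc; +-comm; *-comm; *-identityˡ; <⇒≢; ≤-refl; ≤-trans; 1+n≢0)
  open import Data.Fin.Properties using (toℕ-injective; toℕ-fromℕ<)
  open ≡-Reasoning

  toℕ-shift : ∀ r (t : Fin (suc n)) → toℕ (shift r t) ≡ (toℕ t + r) % suc n
  toℕ-shift r t = toℕ-fromℕ< (m%n<n (toℕ t + r) (suc n))

  shift-shift : ∀ a b (t : Fin (suc n)) → shift a (shift b t) ≡ shift (b + a) t
  shift-shift a b t = toℕ-injective (begin
    toℕ (shift a (shift b t))                   ≡⟨ toℕ-shift a (shift b t) ⟩
    (toℕ (shift b t) + a) % suc n               ≡⟨ cong (λ k → (k + a) % suc n) (toℕ-shift b t) ⟩
    (T % suc n + a) % suc n                     ≡⟨ %-distribˡ-+ (T % suc n) a (suc n) ⟩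
    (T % suc n % suc n + a % suc n) % suc n     ≡⟨ cong (λ k → (k + a % suc n) % suc n) (m%n%n≡m%n T (suc n)) ⟩
    (T % suc n + a % suc n) % suc n             ≡⟨ %-distribˡ-+ T a (suc n) ⟨
    (toℕ t + b + a) % suc n                     ≡⟨ cong (_% suc n) (+-assoc (toℕ t) b a) ⟩
    (toℕ t + (b + a)) % suc n                   ≡⟨ toℕ-shift (b + a) t ⟨
    toℕ (shift (b + a) t)                       ∎)
    where
      T : ℕ
      T = toℕ t + b

  shift-multiple : ∀ k (t : Fin (suc n)) → shift (k * suc n) t ≡ t
  shift-multiple k t = toℕ-injective (begin
    toℕ (shift (k * suc n) t)      ≡⟨ toℕ-shift (k * suc n) t ⟩
    (toℕ t + k * suc n) % suc n    ≡⟨ [m+kn]%n≡m%n (toℕ t) k (suc n) ⟩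
    toℕ t % suc n                  ≡⟨ m<n⇒m%n≡m (toℕ<n t) ⟩
    toℕ t                          ∎)

  shift-zero : ∀ (t : Fin (suc n)) → shift 0 t ≡ t
  shift-zero = shift-multiple 0

  shift-inverseˡ : ∀ r (t : Fin (suc n)) → shift r (shift (n * r) t) ≡ t
  shift-inverseˡ r t = trans (shift-shift r (n * r) t)
    (trans (cong (λ k → shift k t) (trans (+-comm (n * r) r) (*-comm (suc n) r))) (shift-multiple r t))

  shift-inverseʳ : ∀ r (t : Fin (suc n)) → shift (n * r) (shift r t) ≡ t
  shift-inverseʳ r t = trans (shift-shift (n * r) r t)
    (trans (cong (λ k → shift k t) (*-comm (suc n) r)) (shift-multiple r t))

  toℕ-shift-back : ∀ a (t : Fin (suc n)) → toℕ (shift (a + n * toℕ t) t) ≡ a % suc n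
  toℕ-shift-back a t = begin
    toℕ (shift (a + n * toℕ t) t)        ≡⟨ toℕ-shift (a + n * toℕ t) t ⟩
    (toℕ t + (a + n * toℕ t)) % suc n    ≡⟨ cong (_% suc n) (+-comm (toℕ t) (a + n * toℕ t)) ⟩
    (a + n * toℕ t + toℕ t) % suc n      ≡⟨ cong (_% suc n) (+-assoc a (n * toℕ t) (toℕ t)) ⟩
    (a + (n * toℕ t + toℕ t)) % suc n    ≡⟨ cong (λ k → (a + k) % suc n) (+-comm (n * toℕ t) (toℕ t)) ⟩
    (a + suc n * toℕ t) % suc n          ≡⟨ cong (λ k → (a + k) % suc n) (*-comm (suc n) (toℕ t)) ⟩
    (a + toℕ t * suc n) % suc n          ≡⟨ [m+kn]%n≡m%n a (toℕ t) (suc n) ⟩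
    a % suc n                            ∎

  shift-reaches : ∀ (s t : Fin (suc n)) → ∃ λ k → shift k s ≡ t
  shift-reaches s t = toℕ t + n * toℕ s ,
    toℕ-injective (trans (toℕ-shift-back (toℕ t) s) (m<n⇒m%n≡m (toℕ<n t)))

  shift-cancelʳ : ∀ {a b} (t : Fin (suc n)) → a ≤ n → b ≤ n → shift a t ≡ shift b t → a ≡ b
  shift-cancelʳ {a} {b} t a≤n b≤n eq = begin
    a                                     ≡⟨ m≤n⇒m%n≡m a≤n ⟨
    a % suc n                             ≡⟨ toℕ-shift-back a t ⟨
    toℕ (shift (a + n * toℕ t) t)         ≡⟨ cong toℕ (shift-shift (n * toℕ t) a t) ⟨
    toℕ (shift (n * toℕ t) (shift a t))   ≡⟨ cong (λ u → toℕ (shift (n * toℕ t) u)) eq ⟩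
    toℕ (shift (n * toℕ t) (shift b t))   ≡⟨ cong toℕ (shift-shift (n * toℕ t) b t) ⟩
    toℕ (shift (b + n * toℕ t) t)         ≡⟨ toℕ-shift-back b t ⟩
    b % suc n                             ≡⟨ m≤n⇒m%n≡m b≤n ⟩
    b                                     ∎

  next prev : Fin (suc n) → Fin (suc n)
  next = shift 1
  prev = shift n

  prev-next : ∀ i → prev (next i) ≡ i
  prev-next i = trans (shift-shift n 1 i)
    (trans (cong (λ k → shift k i) (sym (*-identityˡ (suc n)))) (shift-multiple 1 i))

  next-prev : ∀ i → next (prev i) ≡ i
  next-prev i = trans (shift-shift 1 n i)
    (trans (cong (λ k → shift k i) (trans (+-comm n 1) (sym (*-identityˡ (suc n))))) (shift-multiple 1 i))

  next≢id : 1 ≤ n → ∀ i → next i ≢ i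
  next≢id 1≤n i eq = 1+n≢0 (shift-cancelʳ i 1≤n z≤n (trans eq (sym (shift-zero i))))

  prev≢next : 2 ≤ n → ∀ i → prev i ≢ next i
  prev≢next 2≤n i eq = <⇒≢ 2≤n (sym (shift-cancelʳ i ≤-refl (≤-trans (s≤s z≤n) 2≤n) eq))

  prev≢next² : 3 ≤ n → ∀ i → prev i ≢ next (next i)
  prev≢next² 3≤n i eq = <⇒≢ 3≤n
    (sym (shift-cancelʳ i ≤-refl (≤-trans (s≤s (s≤s z≤n)) 3≤n) (trans eq (shift-shift 1 1 i))))

  iterate-next : ∀ (t : Fin (suc n)) k → iterate next t k ≡ shift k t
  iterate-next t zero = sym (shift-zero t)
  iterate-next t (suc k) = trans (iterate-next (next t) k) (shift-shift k 1 t)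

  next-last : ∀ (t : Fin (suc n)) → toℕ t ≡ n → next t ≡ zero
  next-last t t≡n = toℕ-injective (begin
    toℕ (next t)          ≡⟨ toℕ-shift 1 t ⟩
    (toℕ t + 1) % suc n   ≡⟨ cong (_% suc n) (trans (+-comm (toℕ t) 1) (cong suc t≡n)) ⟩
    suc n % suc n         ≡⟨ n%n≡0 (suc n) ⟩
    0                     ∎)

  toℕ-next : ∀ (t : Fin (suc n)) → toℕ t < n → toℕ (next t) ≡ suc (toℕ t)
  toℕ-next t t<n = begin
    toℕ (next t)          ≡⟨ toℕ-shift 1 t ⟩
    (toℕ t + 1) % suc n   ≡⟨ cong (_% suc n) (+-comm (toℕ t) 1) ⟩
    suc (toℕ t) % suc n   ≡⟨ m<n⇒m%n≡m (s≤s t<n) ⟩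
    suc (toℕ t)           ∎

  index : ℕ → Fin (suc n)
  index k = shift k zero

  index-toℕ : ∀ i → index (toℕ i) ≡ i
  index-toℕ i = toℕ-injective (trans (toℕ-shift (toℕ i) zero) (m<n⇒m%n≡m (toℕ<n i)))

  next-index : ∀ k → next (index k) ≡ index (suc k)
  next-index k = trans (shift-shift 1 k zero) (cong (λ j → shift j zero) (+-comm k 1))

  prev-index : ∀ k → prev (index (suc k)) ≡ index k
  prev-index k = trans (cong prev (sym (next-index k))) (prev-next (index k))

  prev-index-zero : prev (index 0) ≡ index n
  prev-index-zero = shift-shift n 0 zero

  index-suc≢index-zero : ∀ {k} → k < n → index (suc k) ≢ index 0
  index-suc≢index-zero k<n eq = 1+n≢0 (shift-cancelʳ zero k<n z≤n eq)

open CyclicShift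

open import Data.Integer using (ℤ; 0ℤ; 1ℤ; -1ℤ; _+_; _-_; _<_; +<+; -<+)
open import Algebra.Properties.CommutativeMonoid.Sum ℤ.+-0-commutativeMonoid
  using (sum; sum-permute; sum-cong-≗; ∑-distrib-+; sum-replicate-zero)
open import Algebra.Properties.Group (AbelianGroup.group ℤ.+-0-abelianGroup) using (∙-cancelʳ)

Splits : (ℤ → Set) → Set
Splits P = ∀ i j → P (i + j) → P i ⊎ P j

positive-splits : Splits (0ℤ <_)
positive-splits i j 0<i+j with 0ℤ ℤ.<? i | 0ℤ ℤ.<? j
... | yes 0<i | _       = inj₁ 0<i
... | no _    | yes 0<j = inj₂ 0<j
... | no 0≮i  | no 0≮j  =
  ⊥-elim (ℤ.<-irrefl refl (ℤ.<-≤-trans 0<i+j (ℤ.+-mono-≤ (ℤ.≮⇒≥ 0≮i) (ℤ.≮⇒≥ 0≮j))))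

negative-splits : Splits (_< 0ℤ)
negative-splits i j i+j<0 with i ℤ.<? 0ℤ | j ℤ.<? 0ℤ
... | yes i<0 | _       = inj₁ i<0
... | no _    | yes j<0 = inj₂ j<0
... | no i≮0  | no j≮0  =
  ⊥-elim (ℤ.<-irrefl refl (ℤ.≤-<-trans (ℤ.+-mono-≤ (ℤ.≮⇒≥ i≮0) (ℤ.≮⇒≥ j≮0)) i+j<0))

module Walks (G : DiGraph) where

  open import Data.List.Membership.DecPropositional (_≟ᶠ_ {nV G}) using (_∈?_)

  Vertex Arc : Set
  Vertex = Fin (nV G)
  Arc = Fin (nA G)

  data Walk : Vertex → Vertex → Set where
    []   : ∀ {x} → Walk x x
    step : ∀ {x y} (a : Arc) → src G a ≡ x → Walk (tgt G a) y → Walk x y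

  infixr 5 _++ʷ_
  _++ʷ_ : ∀ {x y z} → Walk x y → Walk y z → Walk x z
  [] ++ʷ q = q
  step a e p ++ʷ q = step a e (p ++ʷ q)

  arcs : ∀ {x y} → Walk x y → List Arc
  arcs [] = []
  arcs (step a _ p) = a ∷ arcs p

  length : ∀ {x y} → Walk x y → ℕ
  length p = List.length (arcs p)

  arcs-++ : ∀ {x y z} (p : Walk x y) (q : Walk y z) → arcs (p ++ʷ q) ≡ arcs p ++ arcs q
  arcs-++ [] q = refl
  arcs-++ (step a _ p) q = cong (a ∷_) (arcs-++ p q)

  length-++ : ∀ {x y z} (p : Walk x y) (q : Walk y z) → length (p ++ʷ q) ≡ length p ℕ.+ length q
  length-++ p q = trans (cong List.length (arcs-++ p q)) (List.length-++ (arcs p))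

  ∈-++ʷ⁺ˡ : ∀ {x y z} (p : Walk x y) (q : Walk y z) {a} → a ∈ arcs p → a ∈ arcs (p ++ʷ q)
  ∈-++ʷ⁺ˡ p q a∈ = subst (_ ∈_) (sym (arcs-++ p q)) (∈-++⁺ˡ a∈)

  ∈-++ʷ⁺ʳ : ∀ {x y z} (p : Walk x y) (q : Walk y z) {a} → a ∈ arcs q → a ∈ arcs (p ++ʷ q)
  ∈-++ʷ⁺ʳ p q a∈ = subst (_ ∈_) (sym (arcs-++ p q)) (∈-++⁺ʳ (arcs p) a∈)

  ∈-++ʷ⁻ : ∀ {x y z} (p : Walk x y) (q : Walk y z) {a} → a ∈ arcs (p ++ʷ q) → a ∈ arcs p ⊎ a ∈ arcs q
  ∈-++ʷ⁻ p q a∈ = ∈-++⁻ (arcs p) (subst (_ ∈_) (arcs-++ p q) a∈)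

  weight : ∀ {x y} → (Arc → ℤ) → Walk x y → ℤ
  weight w [] = 0ℤ
  weight w (step a _ p) = w a + weight w p

  weight-++ : ∀ w {x y z} (p : Walk x y) (q : Walk y z) → weight w (p ++ʷ q) ≡ weight w p + weight w q
  weight-++ w [] q = sym (ℤ.+-identityˡ _)
  weight-++ w (step a _ p) q = trans (cong (w a +_) (weight-++ w p q)) (sym (ℤ.+-assoc (w a) _ _))

  weight-cong : ∀ {w w′ x y} (p : Walk x y) → (∀ {a} → a ∈ arcs p → w a ≡ w′ a) → weight w p ≡ weight w′ p
  weight-cong [] _ = refl
  weight-cong (step a _ p) w≗w′ = cong₂ _+_ (w≗w′ (here refl)) (weight-cong p (w≗w′ ∘′ there))

  weight-vanishes : ∀ {w x y} (p : Walk x y) → (∀ {a} → a ∈ arcs p → w a ≡ 0ℤ) → weight w p ≡ 0ℤ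
  weight-vanishes [] _ = refl
  weight-vanishes (step a _ p) w≡0 = cong₂ _+_ (w≡0 (here refl)) (weight-vanishes p (w≡0 ∘′ there))

  weight-telescope : ∀ (h : Vertex → ℤ) {x y} (p : Walk x y) →
    weight (λ a → h (src G a) - h (tgt G a)) p ≡ h x - h y
  weight-telescope h {x} [] = sym (ℤ.+-inverseʳ (h x))
  weight-telescope h (step a refl p) =
    trans (cong (h (src G a) - h (tgt G a) +_) (weight-telescope h p)) (telescope (h (src G a)) (h (tgt G a)) _)
    where
      telescope : ∀ i j k → i - j + (j - k) ≡ i - k
      telescope = solve-∀

  sources : ∀ {x y} → Walk x y → List Vertex
  sources p = map (src G) (arcs p)

  Simple : ∀ {x y} → Walk x y → Set
  Simple [] = ⊤
  Simple (step a _ p) = src G a ∉ sources p × Simple p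

  split-at : ∀ {x y v} (p : Walk x y) → v ∈ sources p →
    Σ (Walk x v) λ p₁ → Σ (Walk v y) λ p₂ → 0 ℕ.< length p₂ × p ≡ p₁ ++ʷ p₂
  split-at (step a refl p) (here refl) = [] , step a refl p , s≤s z≤n , refl
  split-at (step a refl p) (there v∈) with split-at p v∈
  ... | p₁ , p₂ , p₂≢[] , refl = step a refl p₁ , p₂ , p₂≢[] , refl

  Revisits : ∀ {x y} → Walk x y → Set
  Revisits {x} {y} p = Σ Vertex λ v → Σ (Walk x v) λ p₁ → Σ (Walk v v) λ ℓ → Σ (Walk v y) λ p₂ →
    0 ℕ.< length ℓ × 0 ℕ.< length p₂ × p ≡ p₁ ++ʷ ℓ ++ʷ p₂

  simple-or-revisits : ∀ {x y} (p : Walk x y) → Simple p ⊎ Revisits p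
  simple-or-revisits [] = inj₁ tt
  simple-or-revisits (step a refl p) with simple-or-revisits p
  ... | inj₂ (v , p₁ , ℓ , p₂ , ℓ≢[] , p₂≢[] , refl) =
    inj₂ (v , step a refl p₁ , ℓ , p₂ , ℓ≢[] , p₂≢[] , refl)
  ... | inj₁ simple with src G a ∈? sources p
  ...   | no a∉ = inj₁ (a∉ , simple)
  ...   | yes a∈ with split-at p a∈
  ...     | p₁ , p₂ , p₂≢[] , refl = inj₂ (src G a , [] , step a refl p₁ , p₂ , s≤s z≤n , p₂≢[] , refl)

  module _ {x v y} (p₁ : Walk x v) (ℓ : Walk v v) (p₂ : Walk v y) where

    excise-weight : ∀ w → weight w (p₁ ++ʷ ℓ ++ʷ p₂) ≡ weight w ℓ + weight w (p₁ ++ʷ p₂)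
    excise-weight w = begin
      weight w (p₁ ++ʷ ℓ ++ʷ p₂)                 ≡⟨ weight-++ w p₁ (ℓ ++ʷ p₂) ⟩
      weight w p₁ + weight w (ℓ ++ʷ p₂)          ≡⟨ cong (weight w p₁ +_) (weight-++ w ℓ p₂) ⟩
      weight w p₁ + (weight w ℓ + weight w p₂)   ≡⟨ swap (weight w p₁) (weight w ℓ) (weight w p₂) ⟩
      weight w ℓ + (weight w p₁ + weight w p₂)   ≡⟨ cong (weight w ℓ +_) (weight-++ w p₁ p₂) ⟨
      weight w ℓ + weight w (p₁ ++ʷ p₂)          ∎
      where
        open ≡-Reasoning
        swap : ∀ i j k → i + (j + k) ≡ j + (i + k)
        swap = solve-∀

    excise-length : 0 ℕ.< length ℓ → length (p₁ ++ʷ p₂) ℕ.< length (p₁ ++ʷ ℓ ++ʷ p₂)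
    excise-length ℓ≢[] rewrite length-++ p₁ (ℓ ++ʷ p₂) | length-++ ℓ p₂ | length-++ p₁ p₂ =
      ℕ.+-monoʳ-< (length p₁) (ℕ.+-monoˡ-< (length p₂) ℓ≢[])

    loop-length : 0 ℕ.< length p₂ → length ℓ ℕ.< length (p₁ ++ʷ ℓ ++ʷ p₂)
    loop-length p₂≢[] rewrite length-++ p₁ (ℓ ++ʷ p₂) | length-++ ℓ p₂ =
      ℕ.<-≤-trans (ℕ.m<m+n (length ℓ) p₂≢[]) (ℕ.m≤n+m _ (length p₁))

    excise-⊆ : arcs (p₁ ++ʷ p₂) ⊆ arcs (p₁ ++ʷ ℓ ++ʷ p₂)
    excise-⊆ a∈ with ∈-++ʷ⁻ p₁ p₂ a∈
    ... | inj₁ a∈p₁ = ∈-++ʷ⁺ˡ p₁ (ℓ ++ʷ p₂) a∈p₁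
    ... | inj₂ a∈p₂ = ∈-++ʷ⁺ʳ p₁ (ℓ ++ʷ p₂) (∈-++ʷ⁺ʳ ℓ p₂ a∈p₂)

    loop-⊆ : arcs ℓ ⊆ arcs (p₁ ++ʷ ℓ ++ʷ p₂)
    loop-⊆ = ∈-++ʷ⁺ʳ p₁ (ℓ ++ʷ p₂) ∘′ ∈-++ʷ⁺ˡ ℓ p₂

  simple-subloop : ∀ {P} → Splits P → ∀ w n {x} (p : Walk x x) → length p ℕ.< n → P (weight w p) →
    Σ Vertex λ y → Σ (Walk y y) λ q → Simple q × P (weight w q) × arcs q ⊆ arcs p
  simple-subloop split w zero p () Pp
  simple-subloop {P} split w (suc n) {x} p p<n Pp with simple-or-revisits p
  ... | inj₁ simple = _ , p , simple , Pp , λ a∈ → a∈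
  ... | inj₂ (v , p₁ , ℓ , p₂ , ℓ≢[] , p₂≢[] , refl) =
    [ shorter ℓ (loop-length p₁ ℓ p₂ p₂≢[]) (loop-⊆ p₁ ℓ p₂)
    , shorter (p₁ ++ʷ p₂) (excise-length p₁ ℓ p₂ ℓ≢[]) (excise-⊆ p₁ ℓ p₂)
    ]′ (split _ _ (subst P (excise-weight p₁ ℓ p₂ w) Pp))
    where
      whole : Walk x x
      whole = p₁ ++ʷ ℓ ++ʷ p₂
      shorter : ∀ {z} (q : Walk z z) → length q ℕ.< length whole → arcs q ⊆ arcs whole → P (weight w q) →
        Σ Vertex λ y → Σ (Walk y y) λ r → Simple r × P (weight w r) × arcs r ⊆ arcs whole
      shorter q q<p q⊆p Pq with simple-subloop split w n q (ℕ.<-≤-trans q<p (ℕ.≤-pred p<n)) Pq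
      ... | y , r , simple , Pr , r⊆q = y , r , simple , Pr , q⊆p ∘′ r⊆q

  lookup-chained : ∀ {x y} (p : Walk x y) (i j : Fin (length p)) → toℕ j ≡ suc (toℕ i) →
    tgt G (lookup (arcs p) i) ≡ src G (lookup (arcs p) j)
  lookup-chained (step a _ (step b e p)) zero (suc zero) _ = sym e
  lookup-chained (step a _ p) (suc i) (suc j) j≡i+1 = lookup-chained p i j (ℕ.suc-injective j≡i+1)

  lookup-last : ∀ {x y} (p : Walk x y) (i : Fin (length p)) → suc (toℕ i) ≡ length p →
    tgt G (lookup (arcs p) i) ≡ y
  lookup-last (step a _ []) zero _ = refl
  lookup-last (step a _ p) (suc i) i+1≡len = lookup-last p i (ℕ.suc-injective i+1≡len)

  lookup-src-injective : ∀ {x y} (p : Walk x y) → Simple p → ∀ i j →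
    src G (lookup (arcs p) i) ≡ src G (lookup (arcs p) j) → i ≡ j
  lookup-src-injective (step a _ p) _ zero zero _ = refl
  lookup-src-injective (step a _ p) (a∉ , _) zero (suc j) e =
    ⊥-elim (a∉ (subst (_∈ sources p) (sym e) (∈-map⁺ (src G) (∈-lookup j))))
  lookup-src-injective (step a _ p) (a∉ , _) (suc i) zero e =
    ⊥-elim (a∉ (subst (_∈ sources p) e (∈-map⁺ (src G) (∈-lookup i))))
  lookup-src-injective (step a _ p) (_ , simple) (suc i) (suc j) e =
    cong suc (lookup-src-injective p simple i j e)

  cycle : ∀ {y} a (e : src G a ≡ y) (p : Walk (tgt G a) y) → Simple (step a e p) → SimpleCycle G
  cycle a e p simple = record
    { len      = length p
    ; arc      = lookup (arcs q)
    ; chained  = closes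
    ; distinct = λ {i} {j} → lookup-src-injective q simple i j
    }
    where
      q : Walk _ _
      q = step a e p
      closes : ∀ t → tgt G (lookup (arcs q) t) ≡ src G (lookup (arcs q) (next t))
      closes t with ℕ.m≤n⇒m<n∨m≡n (ℕ.≤-pred (toℕ<n t))
      ... | inj₁ t<len = lookup-chained q t (next t) (toℕ-next t t<len)
      ... | inj₂ t≡len = begin
        tgt G (lookup (arcs q) t)          ≡⟨ lookup-last q t (cong suc t≡len) ⟩
        _                                  ≡⟨ e ⟨
        src G a                            ≡⟨ cong (src G ∘ lookup (arcs q)) (next-last t t≡len) ⟨
        src G (lookup (arcs q) (next t))   ∎
        where open ≡-Reasoning

  cycleWeight : (Arc → ℤ) → SimpleCycle G → ℤ
  cycleWeight w c = sum (w ∘ arc c)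

  sum-lookup : ∀ w {x y} (p : Walk x y) → sum (w ∘ lookup (arcs p)) ≡ weight w p
  sum-lookup w [] = refl
  sum-lookup w (step a _ p) = cong (w a +_) (sum-lookup w p)

  simple-cycle-within : ∀ {P} → Splits P → ¬ P 0ℤ → ∀ w {x} (p : Walk x x) → P (weight w p) →
    Σ (SimpleCycle G) λ Z → P (cycleWeight w Z) × (∀ t → arc Z t ∈ arcs p)
  simple-cycle-within {P} split ¬P0 w p Pp with simple-subloop split w _ p (ℕ.n<1+n _) Pp
  ... | _ , [] , _ , P0 , _ = ⊥-elim (¬P0 P0)
  ... | _ , step a e q , simple , Pq , q⊆p =
    cycle a e q simple , subst P (sym (sum-lookup w (step a e q))) Pq , λ t → q⊆p (∈-lookup t)

  _∈ᵥ_ : Vertex → SimpleCycle G → Set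
  v ∈ᵥ c = ∃ λ t → src G (arc c t) ≡ v

  _∈ₐ_ : Arc → SimpleCycle G → Set
  a ∈ₐ c = ∃ λ t → arc c t ≡ a

  _∈ᵥ?_ : ∀ v (c : SimpleCycle G) → Dec (v ∈ᵥ c)
  v ∈ᵥ? c = any? λ t → src G (arc c t) ≟ᶠ v

  _∈ₐ?_ : ∀ a (c : SimpleCycle G) → Dec (a ∈ₐ c)
  a ∈ₐ? c = any? λ t → arc c t ≟ᶠ a

  src-∈ᵥ : ∀ {a} (c : SimpleCycle G) → a ∈ₐ c → src G a ∈ᵥ c
  src-∈ᵥ c (t , refl) = t , refl

  tgt-∈ᵥ : ∀ {a} (c : SimpleCycle G) → a ∈ₐ c → tgt G a ∈ᵥ c
  tgt-∈ᵥ c (t , refl) = next t , sym (chained c t)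

  share : ∀ (c d : SimpleCycle G) {v} → v ∈ᵥ c → v ∈ᵥ d → ShareVertex c d
  share _ _ (t , e) (s , e′) = t , s , trans e (sym e′)

  ≈rot-∈ᵥ : ∀ (c d : SimpleCycle G) {v} → c ≈rot d → v ∈ᵥ d → v ∈ᵥ c
  ≈rot-∈ᵥ record { len = l } record { len = .l } (refl , r , rot) (t , e) =
    shift r t , trans (cong (src G) (sym (rot t))) e

  ∈ᵥ-≈rot : ∀ (c d : SimpleCycle G) {v} → c ≈rot d → v ∈ᵥ c → v ∈ᵥ d
  ∈ᵥ-≈rot record { len = l ; arc = arcᶜ } record { len = .l } (refl , r , rot) (t , e) =
    shift (l ℕ.* r) t , trans (cong (src G) (trans (rot _) (cong arcᶜ (shift-inverseˡ r t)))) e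

  cycleWeight-≈rot : ∀ w (c d : SimpleCycle G) → c ≈rot d → cycleWeight w c ≡ cycleWeight w d
  cycleWeight-≈rot w record { len = l ; arc = arcᶜ } record { len = .l } (refl , r , rot) = trans
    (sum-permute (w ∘ arcᶜ) (permutation (shift r) (shift (l ℕ.* r)) (shift-inverseˡ r) (shift-inverseʳ r)))
    (sym (sum-cong-≗ (cong w ∘ rot)))

  sum-sources≡sum-targets : ∀ (h : Vertex → ℤ) (c : SimpleCycle G) →
    sum (λ t → h (src G (arc c t))) ≡ sum (λ t → h (tgt G (arc c t)))
  sum-sources≡sum-targets h c = trans
    (sum-permute (λ t → h (src G (arc c t))) (permutation next prev next-prev prev-next))
    (sym (sum-cong-≗ (λ t → cong h (chained c t))))

  cycleWeight-coboundary : ∀ w w′ (h : Vertex → ℤ) (c : SimpleCycle G) →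
    (∀ t → w′ (arc c t) + h (tgt G (arc c t)) ≡ w (arc c t) + h (src G (arc c t))) →
    cycleWeight w′ c ≡ cycleWeight w c
  cycleWeight-coboundary w w′ h c pointwise = ∙-cancelʳ (Σtgt h) _ _ (begin
    cycleWeight w′ c + Σtgt h                        ≡⟨ ∑-distrib-+ (w′ ∘ arc c) (λ t → h (tgt G (arc c t))) ⟨
    sum (λ t → w′ (arc c t) + h (tgt G (arc c t)))   ≡⟨ sum-cong-≗ pointwise ⟩
    sum (λ t → w (arc c t) + h (src G (arc c t)))    ≡⟨ ∑-distrib-+ (w ∘ arc c) (λ t → h (src G (arc c t))) ⟩
    cycleWeight w c + sum (λ t → h (src G (arc c t))) ≡⟨ cong (cycleWeight w c +_) (sum-sources≡sum-targets h c) ⟩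
    cycleWeight w c + Σtgt h                         ∎)
    where
      open ≡-Reasoning
      Σtgt : (Vertex → ℤ) → ℤ
      Σtgt h = sum (λ t → h (tgt G (arc c t)))

  cycleWeight-nonzero : ∀ w (c : SimpleCycle G) → cycleWeight w c ≢ 0ℤ → ∃ λ t → w (arc c t) ≢ 0ℤ
  cycleWeight-nonzero w c total≢0 = ¬∀⟶∃¬ _ (λ t → w (arc c t) ≡ 0ℤ) (λ t → w (arc c t) ℤ.≟ 0ℤ)
    (λ all≡0 → total≢0 (trans (sum-cong-≗ all≡0) (sum-replicate-zero (suc (len c)))))

  Inside : SimpleCycle G → ∀ {x y} → Walk x y → Set
  Inside c p = ∀ {a} → a ∈ arcs p → a ∈ₐ c

  along : ∀ (c : SimpleCycle G) k t {u v} → src G (arc c t) ≡ u → src G (arc c (iterate next t k)) ≡ v →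
    Σ (Walk u v) (Inside c)
  along c zero t refl refl = [] , λ ()
  along c (suc k) t e₁ e₂ with along c k (next t) (sym (chained c t)) e₂
  ... | p , inside = step (arc c t) e₁ p , λ { (here refl) → t , refl ; (there a∈) → inside a∈ }

  -- Opaque because only its type is ever needed, and unfolding it during unification
  -- makes type checking very slow.
  opaque
    within : ∀ (c : SimpleCycle G) {u v} → u ∈ᵥ c → v ∈ᵥ c → Σ (Walk u v) (Inside c)
    within c (t , e₁) (s , e₂) with shift-reaches t s
    ... | k , t+k≡s = along c k t e₁ (trans (cong (src G ∘ arc c) (trans (iterate-next t k) t+k≡s)) e₂)

  ascend : (y : ℕ → Vertex) → (∀ k → Walk (y k) (y (suc k))) → ∀ k → Walk (y 0) (y k)
  ascend y p zero = []
  ascend y p (suc k) = ascend y p k ++ʷ p k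

  descend : (y : ℕ → Vertex) → (∀ k → Walk (y (suc k)) (y k)) → ∀ k → Walk (y k) (y 0)
  descend y p zero = []
  descend y p (suc k) = p k ++ʷ descend y p k

  ∈-ascend : ∀ y p k {a} → a ∈ arcs (ascend y p k) → ∃ λ j → j ℕ.< k × a ∈ arcs (p j)
  ∈-ascend y p (suc k) a∈ with ∈-++ʷ⁻ (ascend y p k) (p k) a∈
  ... | inj₁ a∈rest = let j , j<k , a∈j = ∈-ascend y p k a∈rest in j , ℕ.m<n⇒m<1+n j<k , a∈j
  ... | inj₂ a∈last = k , ℕ.n<1+n k , a∈last

  ∈-descend : ∀ y p k {a} → a ∈ arcs (descend y p k) → ∃ λ j → j ℕ.< k × a ∈ arcs (p j)
  ∈-descend y p (suc k) a∈ with ∈-++ʷ⁻ (p k) (descend y p k) a∈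
  ... | inj₁ a∈first = k , ℕ.n<1+n k , a∈first
  ... | inj₂ a∈rest = let j , j<k , a∈j = ∈-descend y p k a∈rest in j , ℕ.m<n⇒m<1+n j<k , a∈j

  weight-ascend : ∀ w y p k → (∀ j → j ℕ.< k → weight w (p j) ≡ 0ℤ) → weight w (ascend y p k) ≡ 0ℤ
  weight-ascend w y p zero _ = refl
  weight-ascend w y p (suc k) p≡0 = trans (weight-++ w (ascend y p k) (p k))
    (cong₂ _+_ (weight-ascend w y p k (λ j j<k → p≡0 j (ℕ.m<n⇒m<1+n j<k))) (p≡0 k (ℕ.n<1+n k)))

  weight-descend : ∀ w y p k → (∀ j → j ℕ.< k → weight w (p j) ≡ 0ℤ) → weight w (descend y p k) ≡ 0ℤ
  weight-descend w y p zero _ = refl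
  weight-descend w y p (suc k) p≡0 = trans (weight-++ w (p k) (descend y p k))
    (cong₂ _+_ (p≡0 k (ℕ.n<1+n k)) (weight-descend w y p k (λ j j<k → p≡0 j (ℕ.m<n⇒m<1+n j<k))))

𝟙 : Bool → ℤ
𝟙 true = 1ℤ
𝟙 false = 0ℤ

from-does : ∀ {P : Set} (P? : Dec P) → does P? ≡ true → P
from-does (yes p) _ = p

from-¬does : ∀ {P : Set} (P? : Dec P) → does P? ≡ false → ¬ P
from-¬does (no ¬p) _ = ¬p

-- The pointwise identity behind `exits-step`: A and B record whether an arc lies on γᵢ and on
-- γᵢ₊₁, and b₁, b₂ (c₁, c₂) whether its source and target lie on γᵢ₋₁ (on γᵢ).
exits-step-indicators : ∀ A B b₁ b₂ c₁ c₂ →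
  (A ≡ true → c₁ ≡ true × c₂ ≡ true) →
  (B ≡ true → b₁ ≡ false × b₂ ≡ false) →
  (A ≡ false → B ≡ false → (b₁ ≡ true × b₂ ≡ true) ⊎ (c₁ ≡ false × c₂ ≡ false)) →
  𝟙 (B ∧ c₁) - 𝟙 (B ∧ c₂) + 𝟙 (c₂ ∧ not b₂) ≡ 𝟙 (A ∧ b₁) - 𝟙 (A ∧ b₂) + 𝟙 (c₁ ∧ not b₁)
exits-step-indicators true true b₁ b₂ c₁ c₂ onA onB _ with onA refl | onB refl
... | refl , refl | refl , refl = refl
exits-step-indicators true false b₁ b₂ c₁ c₂ onA _ _ with onA refl | b₁ | b₂
... | refl , refl | false | false = refl
... | refl , refl | false | true  = refl
... | refl , refl | true  | false = refl
... | refl , refl | true  | true  = refl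
exits-step-indicators false true b₁ b₂ c₁ c₂ _ onB _ with onB refl | c₁ | c₂
... | refl , refl | false | false = refl
... | refl , refl | false | true  = refl
... | refl , refl | true  | false = refl
... | refl , refl | true  | true  = refl
exits-step-indicators false false b₁ b₂ c₁ c₂ _ _ elsewhere with elsewhere refl refl
... | inj₁ (refl , refl) rewrite ∧-zeroʳ c₁ | ∧-zeroʳ c₂ = refl
... | inj₂ (refl , refl) = refl

Edge-sym : ∀ (H : SimpleGraph) {u v} → Edge H u v → Edge H v u
Edge-sym H {u} {v} e = trans (adj-sym H v u) e

module Realization
  (H : SimpleGraph) (G : DiGraph) (f : Fin (N H) → SimpleCycle G)
  (edge⇔share : ∀ u v → (Edge H u v → (u ≢ v × ShareVertex (f u) (f v)))
                       × ((u ≢ v × ShareVertex (f u) (f v)) → Edge H u v))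
  {m : ℕ} (3≤m : 3 ≤ m) (C : InducedCycle H m) where

  open Walks G

  Index : Set
  Index = Fin (suc m)

  γ : Index → SimpleCycle G
  γ i = f (vtx C i)

  meet : ∀ {i j v} → v ∈ᵥ γ i → v ∈ᵥ γ j → i ≡ j ⊎ j ≡ next i ⊎ i ≡ next j
  meet {i} {j} v∈i v∈j with i ≟ᶠ j
  ... | yes i≡j = inj₁ i≡j
  ... | no i≢j = inj₂ (no-chord C i j (proj₂ (edge⇔share (vtx C i) (vtx C j))
                   ((λ cᵢ≡cⱼ → i≢j (inj C cᵢ≡cⱼ)) , share (γ i) (γ j) v∈i v∈j)))

  disjoint : ∀ {i v} → v ∈ᵥ γ (prev i) → v ∈ᵥ γ (next i) → ⊥
  disjoint {i} v∈p v∈n with meet v∈p v∈n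
  ... | inj₁ p≡n = prev≢next (ℕ.<⇒≤ 3≤m) i p≡n
  ... | inj₂ (inj₁ n≡np) = next≢id (ℕ.<⇒≤ (ℕ.<⇒≤ 3≤m)) i (trans n≡np (next-prev i))
  ... | inj₂ (inj₂ p≡nn) = prev≢next² 3≤m i p≡nn

  far : ∀ {i k v} → k ≢ prev i → k ≢ i → k ≢ next i → v ∈ᵥ γ k → v ∈ᵥ γ i → ⊥
  far {i} {k} k≢p k≢i k≢n v∈k v∈i with meet v∈k v∈i
  ... | inj₁ k≡i = k≢i k≡i
  ... | inj₂ (inj₁ i≡nk) = k≢p (trans (sym (prev-next k)) (cong prev (sym i≡nk)))
  ... | inj₂ (inj₂ k≡ni) = k≢n k≡ni

  onγ : Index → Vertex → Bool
  onγ i v = does (v ∈ᵥ? γ i)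

  onγ-true : ∀ i {v} → v ∈ᵥ γ i → onγ i v ≡ true
  onγ-true i = dec-true (_ ∈ᵥ? γ i)

  onγ-false : ∀ i {v} → ¬ v ∈ᵥ γ i → onγ i v ≡ false
  onγ-false i = dec-false (_ ∈ᵥ? γ i)

  alongγ : Index → Arc → Bool
  alongγ i a = does (a ∈ₐ? γ i)

  exits : Index → Index → Arc → ℤ
  exits k j a = 𝟙 (alongγ j a ∧ onγ k (src G a)) - 𝟙 (alongγ j a ∧ onγ k (tgt G a))

  flux : Index → Arc → ℤ
  flux j = exits (prev j) j

  potential : Index → Vertex → ℤ
  potential i v = 𝟙 (onγ i v ∧ not (onγ (prev i) v))

  InUnion : Arc → Set
  InUnion a = ∃ λ k → a ∈ₐ γ k

  exits-along : ∀ k {j a} → a ∈ₐ γ j → exits k j a ≡ 𝟙 (onγ k (src G a)) - 𝟙 (onγ k (tgt G a))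
  exits-along k {j} {a} a∈j =
    cong (λ A → 𝟙 (A ∧ onγ k (src G a)) - 𝟙 (A ∧ onγ k (tgt G a))) (dec-true (a ∈ₐ? γ j) a∈j)

  exits-outside : ∀ k {j a} → ¬ a ∈ₐ γ j → exits k j a ≡ 0ℤ
  exits-outside k {j} {a} a∉j =
    cong (λ A → 𝟙 (A ∧ onγ k (src G a)) - 𝟙 (A ∧ onγ k (tgt G a))) (dec-false (a ∈ₐ? γ j) a∉j)

  flux-support : ∀ {j a} → flux j a ≢ 0ℤ → a ∈ₐ γ j
  flux-support {j} {a} flux≢0 = decidable-stable (a ∈ₐ? γ j) (flux≢0 ∘ exits-outside (prev j))

  exits-step : ∀ i {a} → InUnion a →
    exits i (next i) a + potential i (tgt G a) ≡ exits (prev i) i a + potential i (src G a)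
  exits-step i {a} (k , a∈k) =
    exits-step-indicators (alongγ i a) (alongγ (next i) a) _ _ _ _ on-γᵢ on-γᵢ₊₁ elsewhere
    where
      on-γᵢ : alongγ i a ≡ true → onγ i (src G a) ≡ true × onγ i (tgt G a) ≡ true
      on-γᵢ A = let a∈i = from-does (a ∈ₐ? γ i) A in
        onγ-true i (src-∈ᵥ (γ i) a∈i) , onγ-true i (tgt-∈ᵥ (γ i) a∈i)

      on-γᵢ₊₁ : alongγ (next i) a ≡ true → onγ (prev i) (src G a) ≡ false × onγ (prev i) (tgt G a) ≡ false
      on-γᵢ₊₁ B = let a∈n = from-does (a ∈ₐ? γ (next i)) B in
        onγ-false (prev i) (λ s∈ → disjoint {i} s∈ (src-∈ᵥ (γ (next i)) a∈n)) ,
        onγ-false (prev i) (λ t∈ → disjoint {i} t∈ (tgt-∈ᵥ (γ (next i)) a∈n))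

      elsewhere : alongγ i a ≡ false → alongγ (next i) a ≡ false →
        (onγ (prev i) (src G a) ≡ true × onγ (prev i) (tgt G a) ≡ true)
        ⊎ (onγ i (src G a) ≡ false × onγ i (tgt G a) ≡ false)
      elsewhere A B with k ≟ᶠ prev i
      ... | yes refl = inj₁ (onγ-true (prev i) (src-∈ᵥ (γ k) a∈k) , onγ-true (prev i) (tgt-∈ᵥ (γ k) a∈k))
      ... | no k≢p = inj₂ (onγ-false i (far k≢p k≢i k≢n (src-∈ᵥ (γ k) a∈k)) ,
                           onγ-false i (far k≢p k≢i k≢n (tgt-∈ᵥ (γ k) a∈k)))
        where
          k≢i : k ≢ i
          k≢i refl = from-¬does (a ∈ₐ? γ i) A a∈k
          k≢n : k ≢ next i
          k≢n refl = from-¬does (a ∈ₐ? γ (next i)) B a∈k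

  flux-next : ∀ i Z → (∀ t → InUnion (arc Z t)) → cycleWeight (flux (next i)) Z ≡ cycleWeight (flux i) Z
  flux-next i Z inUnion = cycleWeight-coboundary (flux i) (flux (next i)) (potential i) Z λ t →
    subst (λ k → exits k (next i) (arc Z t) + potential i (tgt G (arc Z t))
                   ≡ flux i (arc Z t) + potential i (src G (arc Z t)))
          (sym (prev-next i)) (exits-step i (inUnion t))

  flux-invariant : ∀ Z → (∀ t → InUnion (arc Z t)) → ∀ i →
    cycleWeight (flux i) Z ≡ cycleWeight (flux (index 0)) Z
  flux-invariant Z inUnion i = subst (λ j → cycleWeight (flux j) Z ≡ _) (index-toℕ i) (from-index (toℕ i))
    where
      from-index : ∀ k → cycleWeight (flux (index k)) Z ≡ cycleWeight (flux (index 0)) Z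
      from-index zero = refl
      from-index (suc k) = trans (cong (λ j → cycleWeight (flux j) Z) (sym (next-index k)))
                                 (trans (flux-next (index k) Z inUnion) (from-index k))

  flux-inside : ∀ j {u v} (p : Walk u v) → Inside (γ j) p →
    weight (flux j) p ≡ 𝟙 (onγ (prev j) u) - 𝟙 (onγ (prev j) v)
  flux-inside j p inside =
    trans (weight-cong p (exits-along (prev j) ∘ inside)) (weight-telescope (𝟙 ∘ onγ (prev j)) p)

  flux-vanishes : ∀ {j k u v} (p : Walk u v) → Inside (γ k) p → k ≢ j → weight (flux j) p ≡ 0ℤ
  flux-vanishes {j} {k} p inside k≢j = weight-vanishes p (vanishes ∘ inside)
    where
      endpoints : ∀ {a} → a ∈ₐ γ j → ∀ b → onγ (prev j) (src G a) ≡ b → onγ (prev j) (tgt G a) ≡ b →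
        flux j a ≡ 0ℤ
      endpoints a∈j b s≡b t≡b =
        trans (exits-along (prev j) a∈j) (trans (cong₂ (λ b₁ b₂ → 𝟙 b₁ - 𝟙 b₂) s≡b t≡b) (𝟙b-𝟙b b))
        where
          𝟙b-𝟙b : ∀ b → 𝟙 b - 𝟙 b ≡ 0ℤ
          𝟙b-𝟙b true = refl
          𝟙b-𝟙b false = refl
      vanishes : ∀ {a} → a ∈ₐ γ k → flux j a ≡ 0ℤ
      vanishes {a} a∈k with a ∈ₐ? γ j
      ... | no a∉j = exits-outside (prev j) a∉j
      ... | yes a∈j with meet (src-∈ᵥ (γ k) a∈k) (src-∈ᵥ (γ j) a∈j)
      ...   | inj₁ k≡j = ⊥-elim (k≢j k≡j)
      ...   | inj₂ (inj₁ j≡nk) = endpoints a∈j true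
              (onγ-true (prev j) (src-∈ᵥ (γ (prev j)) a∈γₚ)) (onγ-true (prev j) (tgt-∈ᵥ (γ (prev j)) a∈γₚ))
        where
          a∈γₚ : a ∈ₐ γ (prev j)
          a∈γₚ = subst (λ i → a ∈ₐ γ i) (trans (sym (prev-next k)) (cong prev (sym j≡nk))) a∈k
      ...   | inj₂ (inj₂ k≡nj) = endpoints a∈j false
              (onγ-false (prev j) (λ s∈ → disjoint {j} s∈ (src-∈ᵥ (γ (next j)) a∈γₙ)))
              (onγ-false (prev j) (λ t∈ → disjoint {j} t∈ (tgt-∈ᵥ (γ (next j)) a∈γₙ)))
        where
          a∈γₙ : a ∈ₐ γ (next j)
          a∈γₙ = subst (λ i → a ∈ₐ γ i) k≡nj a∈k

  flux-leaving : ∀ i {u v} (p : Walk u v) → Inside (γ i) p → u ∈ᵥ γ (prev i) → ¬ v ∈ᵥ γ (prev i) →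
    weight (flux i) p ≡ 1ℤ
  flux-leaving i p inside u∈ v∉ = trans (flux-inside i p inside)
    (cong₂ (λ b₁ b₂ → 𝟙 b₁ - 𝟙 b₂) (onγ-true (prev i) u∈) (onγ-false (prev i) v∉))

  flux-entering : ∀ i {u v} (p : Walk u v) → Inside (γ i) p → ¬ u ∈ᵥ γ (prev i) → v ∈ᵥ γ (prev i) →
    weight (flux i) p ≡ -1ℤ
  flux-entering i p inside u∉ v∈ = trans (flux-inside i p inside)
    (cong₂ (λ b₁ b₂ → 𝟙 b₁ - 𝟙 b₂) (onγ-false (prev i) u∉) (onγ-true (prev i) v∈))

  shared : ∀ i → ShareVertex (γ i) (γ (next i))
  shared i = proj₂ (proj₁ (edge⇔share (vtx C i) (vtx C (next i))) (consec C i))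

  x : Index → Vertex
  x i = src G (arc (γ i) (proj₁ (shared i)))

  x∈γ : ∀ i → x i ∈ᵥ γ i
  x∈γ i = proj₁ (shared i) , refl

  x∈γ-next : ∀ i → x i ∈ᵥ γ (next i)
  x∈γ-next i = proj₁ (proj₂ (shared i)) , sym (proj₂ (proj₂ (shared i)))

  x-prev∈γ : ∀ i → x (prev i) ∈ᵥ γ i
  x-prev∈γ i = subst (λ j → x (prev i) ∈ᵥ γ j) (next-prev i) (x∈γ-next (prev i))

  x∉γ-prev : ∀ i → ¬ x i ∈ᵥ γ (prev i)
  x∉γ-prev i x∈ = disjoint {i} x∈ (x∈γ-next i)

  i₀ : Index
  i₀ = index 0

  x-index∈γ : ∀ k → x (index k) ∈ᵥ γ (index (suc k))
  x-index∈γ k = subst (λ j → x j ∈ᵥ γ (index (suc k))) (prev-index k) (x-prev∈γ (index (suc k)))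

  x-last : ∀ {j} → x (prev i₀) ∈ᵥ γ j → x (index m) ∈ᵥ γ j
  x-last {j} = subst (λ k → x k ∈ᵥ γ j) prev-index-zero

  rise : ∀ k → Σ (Walk (x (index k)) (x (index (suc k)))) (Inside (γ (index (suc k))))
  rise k = within (γ (index (suc k))) (x-index∈γ k) (x∈γ (index (suc k)))

  fall : ∀ k → Σ (Walk (x (index (suc k))) (x (index k))) (Inside (γ (index (suc k))))
  fall k = within (γ (index (suc k))) (x∈γ (index (suc k))) (x-index∈γ k)

  closing : Σ (Walk (x (index m)) (x i₀)) (Inside (γ i₀))
  closing = within (γ i₀) (x-last (x-prev∈γ i₀)) (x∈γ i₀)

  opening : Σ (Walk (x i₀) (x (index m))) (Inside (γ i₀))
  opening = within (γ i₀) (x∈γ i₀) (x-last (x-prev∈γ i₀))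

  rises : Walk (x i₀) (x (index m))
  rises = ascend (x ∘ index) (proj₁ ∘ rise) m

  falls : Walk (x (index m)) (x i₀)
  falls = descend (x ∘ index) (proj₁ ∘ fall) m

  forward backward : Walk (x i₀) (x i₀)
  forward = rises ++ʷ proj₁ closing
  backward = proj₁ opening ++ʷ falls

  forward-flux : weight (flux i₀) forward ≡ 1ℤ
  forward-flux = trans (weight-++ (flux i₀) rises (proj₁ closing)) (cong₂ _+_
    (weight-ascend (flux i₀) (x ∘ index) (proj₁ ∘ rise) m
      (λ j j<m → flux-vanishes (proj₁ (rise j)) (proj₂ (rise j)) (index-suc≢index-zero j<m)))
    (flux-leaving i₀ (proj₁ closing) (proj₂ closing) (x-last (x∈γ (prev i₀))) (x∉γ-prev i₀)))

  backward-flux : weight (flux i₀) backward ≡ -1ℤ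
  backward-flux = trans (weight-++ (flux i₀) (proj₁ opening) falls) (cong₂ _+_
    (flux-entering i₀ (proj₁ opening) (proj₂ opening) (x∉γ-prev i₀) (x-last (x∈γ (prev i₀))))
    (weight-descend (flux i₀) (x ∘ index) (proj₁ ∘ fall) m
      (λ j j<m → flux-vanishes (proj₁ (fall j)) (proj₂ (fall j)) (index-suc≢index-zero j<m))))

  forward-inUnion : ∀ {a} → a ∈ arcs forward → InUnion a
  forward-inUnion a∈ = [ in-rises , (λ a∈closing → i₀ , proj₂ closing a∈closing) ]′
    (∈-++ʷ⁻ rises (proj₁ closing) a∈)
    where
      in-rises : ∀ {a} → a ∈ arcs rises → InUnion a
      in-rises a∈ = let j , _ , a∈j = ∈-ascend (x ∘ index) (proj₁ ∘ rise) m a∈ in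
        index (suc j) , proj₂ (rise j) a∈j

  backward-inUnion : ∀ {a} → a ∈ arcs backward → InUnion a
  backward-inUnion a∈ = [ (λ a∈opening → i₀ , proj₂ opening a∈opening) , in-falls ]′
    (∈-++ʷ⁻ (proj₁ opening) falls a∈)
    where
      in-falls : ∀ {a} → a ∈ arcs falls → InUnion a
      in-falls a∈ = let j , _ , a∈j = ∈-descend (x ∘ index) (proj₁ ∘ fall) m a∈ in
        index (suc j) , proj₂ (fall j) a∈j

  Near : Fin (N H) → Set
  Near v = (∃ λ i → v ≡ vtx C i) ⊎ (∃ λ i → Edge H v (vtx C i))

  module _ (Z : SimpleCycle G) (inUnion : ∀ t → InUnion (arc Z t))
           (flux≢0 : cycleWeight (flux i₀) Z ≢ 0ℤ) where

    -- Opaque for the same reason as `within`.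
    opaque
      meets : ∀ i → ∃ λ v → v ∈ᵥ Z × v ∈ᵥ γ i
      meets i with cycleWeight-nonzero (flux i) Z (flux≢0 ∘ trans (sym (flux-invariant Z inUnion i)))
      ... | t , fluxₜ≢0 = src G (arc Z t) , (t , refl) , src-∈ᵥ (γ i) (flux-support fluxₜ≢0)

    module _ (u : Fin (N H)) (u≈Z : f u ≈rot Z) where

      u≢c : ∀ i → u ≢ vtx C i
      u≢c i u≡cᵢ with meets (next (next i))
      ... | w , w∈Z , w∈γₙₙ = disjoint {next i}
        (subst (λ j → w ∈ᵥ γ j) (sym (prev-next i)) (subst (λ y → w ∈ᵥ f y) u≡cᵢ (≈rot-∈ᵥ (f u) Z u≈Z w∈Z)))
        w∈γₙₙ

      adjacent-all : ∀ i → Edge H u (vtx C i)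
      adjacent-all i with meets i
      ... | v , v∈Z , v∈γᵢ =
        proj₂ (edge⇔share u (vtx C i)) (u≢c i , share (f u) (γ i) (≈rot-∈ᵥ (f u) Z u≈Z v∈Z) v∈γᵢ)

      near : ∀ v → Edge H v u → Near v
      near v v~u with proj₂ (proj₁ (edge⇔share v u) v~u)
      ... | t , s , e with ∈ᵥ-≈rot (f u) Z u≈Z (s , refl)
      ... | t′ , e′ with inUnion t′
      ... | k , a∈γₖ with v ≟ᶠ vtx C k
      ...   | yes v≡cₖ = inj₁ (k , v≡cₖ)
      ...   | no v≢cₖ = inj₂ (k , proj₂ (edge⇔share v (vtx C k))
                          (v≢cₖ , share (f v) (γ k) (t , e) (subst (_∈ᵥ γ k) e′ (src-∈ᵥ (γ k) a∈γₖ))))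

  record Representative (P : ℤ → Set) : Set where
    field
      vertex   : Fin (N H)
      sign     : P (cycleWeight (flux i₀) (f vertex))
      adjacent : ∀ i → Edge H vertex (vtx C i)
      nearby   : ∀ v → Edge H v vertex → Near v

  representative : ∀ {P} → (∀ c → ∃ λ u → f u ≈rot c) → Splits P → ¬ P 0ℤ →
    (p : Walk (x i₀) (x i₀)) → (∀ {a} → a ∈ arcs p → InUnion a) → P (weight (flux i₀) p) →
    Representative P
  representative {P} onto split ¬P0 p p⊆∪ Pp with simple-cycle-within split ¬P0 (flux i₀) p Pp
  ... | Z , PZ , Z⊆p with onto Z
  ... | u , u≈Z = record
    { vertex   = u
    ; sign     = subst P (sym (cycleWeight-≈rot (flux i₀) (f u) Z u≈Z)) PZ
    ; adjacent = adjacent-all Z Z⊆∪ flux≢0 u u≈Z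
    ; nearby   = near Z Z⊆∪ flux≢0 u u≈Z
    }
    where
      Z⊆∪ : ∀ t → InUnion (arc Z t)
      Z⊆∪ t = p⊆∪ (Z⊆p t)
      flux≢0 : cycleWeight (flux i₀) Z ≢ 0ℤ
      flux≢0 eq = ¬P0 (subst P eq PZ)

  opposite-signs-distinct : (w₊ : Representative (0ℤ <_)) (w₋ : Representative (_< 0ℤ)) →
    Representative.vertex w₊ ≢ Representative.vertex w₋
  opposite-signs-distinct w₊ w₋ eq =
    ℤ.<-asym (sign w₊) (subst (λ u → cycleWeight (flux i₀) (f u) < 0ℤ) (sym eq) (sign w₋))
    where open Representative

proposition2 : (H : SimpleGraph) → Realizable H →
    (m : ℕ) → 4 ≤ suc m → (C : InducedCycle H m) →
    Σ (Fin (N H)) λ w₁ → Σ (Fin (N H)) λ w₂ →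
      w₁ ≢ w₂
      × (∀ i → Edge H w₁ (vtx C i) × Edge H w₂ (vtx C i))
      × (∀ v → (Edge H v w₁ ⊎ Edge H v w₂) →
           (∃ λ i → v ≡ vtx C i) ⊎ (∃ λ i → Edge H v (vtx C i)))
      × (¬ Edge H w₁ w₂ →
           ∀ i → ∃ λ c′ → Edge H (vtx C i) c′ × Edge H (vtx C (shift 1 i)) c′)
proposition2 H (G , f , _ , onto , edge⇔share) m 4≤n C =
  vertex w₊ , vertex w₋ , opposite-signs-distinct w₊ w₋ ,
  (λ i → adjacent w₊ i , adjacent w₋ i) ,
  (λ v → [ nearby w₊ v , nearby w₋ v ]′) ,
  λ _ i → vertex w₊ , Edge-sym H (adjacent w₊ i) , Edge-sym H (adjacent w₊ (next i))
  where
    open Realization H G f edge⇔share (ℕ.≤-pred 4≤n) C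
    open Representative

    w₊ : Representative (0ℤ <_)
    w₊ = representative onto positive-splits (ℤ.<-irrefl refl) forward forward-inUnion
           (subst (0ℤ <_) (sym forward-flux) (+<+ (s≤s z≤n)))

    w₋ : Representative (_< 0ℤ)
    w₋ = representative onto negative-splits (ℤ.<-irrefl refl) backward backward-inUnion
           (subst (_< 0ℤ) (sym backward-flux) -<+)
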